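{- Let $G=(V,E)$ be a simple undirected graph on $n$ vertices, $s\ge1$, and let $r,q$ be positive integers. Let $X$ be the value returned by the algorithm $\mathrm{Approx}_s(r,q)$ run on $G$. Then $\mathbb{E}[X]=\bar\mu_s$, where $\bar\mu_s=\frac1n\sum_{v\in V}d_v^s$.
   Context: $d_v$ is the degree of $v$, $\Gamma(v)$ its neighbor set; vertices have distinct identifiers $id(\cdot)$. Degree ordering: $u\prec v$ iff $d_u<d_v$, or $d_u=d_v$ and $id(u)<id(v)$. Algorithm $\mathrm{Approx}_s(r,q)$: (1) Select $r$ vertices uniformly, independently at random; let $R$ be the resulting multiset and query the degree of each vertex in $R$; let $d_R=\sum_{v\in R}d_v$. (2) For $i=1,\dots,q$: select an element $v_i$ of $R$ with probability $d_{v_i}/d_R$ (i.e., proportional to its degree, counting multiplicities), and query a uniformly random neighbor $u_i$ of $v_i$; if $v_i\prec u_i$ set $X_i=d_{v_i}^{s-1}+d_{u_i}^{s-1}$, otherwise set $X_i=0$. (3) Return $X=\frac1r\cdot\frac{d_R}{q}\cdot\sum_{i=1}^q X_i$. -}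

module Defs where

open import Data.Bool using (Bool; true; false; T; if_then_else_)
open import Data.Bool.Properties using (T?)
open import Data.Nat as ℕ using (ℕ; zero; suc; _∸_; _^_; NonZero)
open import Data.Nat using (_<ᵇ_; _≡ᵇ_)
open import Data.Fin using (Fin; toℕ)
open import Data.List using (List; []; _∷_; map; concatMap; filter; length; foldr; replicate)
open import Data.List.Base using (allFin)
open import Data.Product using (_×_; _,_)
open import Data.Integer using (+_)
open import Data.Rational using (ℚ; 0ℚ; 1ℚ; _+_; _*_; _/_)
open import Relation.Binary.PropositionalEquality using (_≡_)

-- Finite probability distributions: a list of (probability, outcome)
-- pairs (duplicated outcomes allowed).  Expectation is Σ p · x.

Dist : Set → Set
Dist A = List (ℚ × A)

return : {A : Set} → A → Dist A
return x = (1ℚ , x) ∷ []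

_>>=_ : {A B : Set} → Dist A → (A → Dist B) → Dist B
m >>= f = concatMap (λ { (p , a) → map (λ { (p′ , b) → (p * p′ , b) }) (f a) }) m

uniformList : {A : Set} → List A → Dist A
uniformList [] = []
uniformList (x ∷ xs) = map (λ y → (+ 1 / suc (length xs) , y)) (x ∷ xs)

iid : {A : Set} → ℕ → Dist A → Dist (List A)
iid zero     D = return []
iid (suc k)  D = D >>= λ a → iid k D >>= λ as → return (a ∷ as)

expectation : Dist ℚ → ℚ
expectation = foldr (λ { (p , x) acc → p * x + acc }) 0ℚ

fromℕ : ℕ → ℚ
fromℕ m = + m / 1

sumℕ : List ℕ → ℕ
sumℕ = foldr ℕ._+_ 0

-- Simple undirected graphs on vertex set Fin n; id(v) = toℕ v.

record SimpleGraph (n : ℕ) : Set where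
  field
    adj    : Fin n → Fin n → Bool
    sym    : ∀ u v → adj u v ≡ adj v u
    irrefl : ∀ v → adj v v ≡ false

module _ {n : ℕ} (G : SimpleGraph n) where
  open SimpleGraph G

  Γ : Fin n → List (Fin n)
  Γ v = filter (λ u → T? (adj v u)) (allFin n)

  deg : Fin n → ℕ
  deg v = length (Γ v)

  _≺_ : Fin n → Fin n → Bool
  u ≺ v = if deg u <ᵇ deg v then true
          else (if deg u ≡ᵇ deg v then toℕ u <ᵇ toℕ v else false)

  μ̄ : (s : ℕ) → .{{NonZero n}} → ℚ
  μ̄ s = (+ 1 / n) * fromℕ (sumℕ (map (λ v → deg v ^ s) (allFin n)))

  -- step (2), one round: pick v ∈ R with prob. d_v / d_R (multiplicities
  -- counted), then a uniform neighbour u of v; return X_i.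
  oneSample : (s : ℕ) (R : List (Fin n)) (dR : ℕ) → .{{NonZero dR}} → Dist ℕ
  oneSample s R dR =
    map (λ v → (+ deg v / dR , v)) R >>= λ v →
    uniformList (Γ v) >>= λ u →
    return (if v ≺ u then deg v ^ (s ∸ 1) ℕ.+ deg u ^ (s ∸ 1) else 0)

  -- the whole algorithm Approx_s(r,q); its output X as a distribution.
  -- If d_R = 0 the output is 0 (the factor d_R vanishes; step (2) is vacuous).
  Approx : (s r q : ℕ) → .{{NonZero n}} → .{{NonZero r}} → .{{NonZero q}} → Dist ℚ
  Approx s r q =
    iid r (uniformList (allFin n)) >>= λ R →
    finish R (sumℕ (map deg R))
    where
    finish : List (Fin n) → ℕ → Dist ℚ
    finish R zero = return 0ℚ
    finish R (suc k) =
      iid q (oneSample s R (suc k)) >>= λ Xs →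
      return ((+ 1 / r) * (+ suc k / q) * fromℕ (sumℕ Xs))

{-# OPTIONS --safe #-}

-- Drawing v ∈ R with probability d_v / d_R and then a uniform neighbour u picks each
-- oriented edge (v, u) leaving R with probability 1 / d_R.  Hence, given R, every X_i has
-- mean (1 / d_R) Σ_{v ∈ R} f(v) with f(v) = Σ_{u ∈ Γ(v)} [v ≺ u] (d_v^{s-1} + d_u^{s-1}),
-- the factors d_R and q cancel, and averaging over the r uniform draws of R leaves
-- (1 / n) Σ_v f(v).  Since ≺ orients every edge exactly one way, the edge {u, v} contributes
-- d_u^{s-1} + d_v^{s-1} to Σ_v f(v) exactly once, so Σ_v f(v) = Σ_v d_v · d_v^{s-1} = Σ_v d_v^s.

module Submission where

open import Defs
open import Data.Nat using (ℕ; _≥_; NonZero)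
open import Relation.Binary.PropositionalEquality using (_≡_)

open import Algebra.Bundles using (CommutativeMonoid)
import Algebra.Properties.CommutativeSemigroup as CommSemigroup
open import Data.Bool using (Bool; true; false; not; if_then_else_)
open import Data.Bool.Properties using (T?)
open import Data.Fin using (Fin)
open import Data.Fin.Properties using (toℕ-injective)
open import Data.List using (List; []; _∷_; map; _++_; filter; length; allFin)
open import Data.List.Properties using (map-cong; map-id; length-tabulate)
open import Data.Nat using (zero; suc; _^_; _∸_; _<ᵇ_; _≡ᵇ_)
import Data.Nat as ℕ
import Data.Nat.Properties as ℕ
open import Data.Product using (_,_; proj₁; proj₂; Σ-syntax)
open import Function using (id; _∘_; case_of_)
open import Relation.Binary.PropositionalEquality
  using (refl; sym; trans; cong; cong₂; _≢_; module ≡-Reasoning)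
open import Relation.Nullary using (yes; no; contradiction)

module _ where
  open import Data.Nat using (_+_; _*_)
  open CommSemigroup ℕ.+-commutativeSemigroup using (interchange)

  ∑ : {A : Set} → List A → (A → ℕ) → ℕ
  ∑ L h = sumℕ (map h L)

  syntax ∑ L (λ x → e) = ∑[ x ∈ L ] e

  infixr 7 [_]·_

  [_]·_ : Bool → ℕ → ℕ
  [ b ]· c = if b then c else 0

  []·-distrib-+ : ∀ b x y → [ b ]· (x + y) ≡ [ b ]· x + [ b ]· y
  []·-distrib-+ true  x y = refl
  []·-distrib-+ false x y = refl

  []·-+-[not]· : ∀ b c → [ b ]· c + [ not b ]· c ≡ c
  []·-+-[not]· true  c = ℕ.+-identityʳ c
  []·-+-[not]· false c = refl

  module _ {A : Set} where

    ∑-cong : ∀ {f g : A → ℕ} L → (∀ x → f x ≡ g x) → ∑ L f ≡ ∑ L g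
    ∑-cong L f≗g = cong sumℕ (map-cong f≗g L)

    ∑-+ : ∀ (f g : A → ℕ) L → ∑[ x ∈ L ] (f x + g x) ≡ ∑ L f + ∑ L g
    ∑-+ f g []      = refl
    ∑-+ f g (x ∷ L) = trans (cong (f x + g x +_) (∑-+ f g L))
                            (interchange (f x) (g x) (∑ L f) (∑ L g))

    ∑-const : ∀ c (L : List A) → ∑[ _ ∈ L ] c ≡ length L * c
    ∑-const c []      = refl
    ∑-const c (x ∷ L) = cong (c +_) (∑-const c L)

    ∑-filter : ∀ (p : A → Bool) (h : A → ℕ) L →
               ∑ (filter (T? ∘ p) L) h ≡ ∑[ x ∈ L ] ([ p x ]· h x)
    ∑-filter p h []      = refl
    ∑-filter p h (x ∷ L) with p x
    ... | true  = cong (h x +_) (∑-filter p h L)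
    ... | false = ∑-filter p h L

    ∑-comm : ∀ (F : A → A → ℕ) L M → ∑[ x ∈ L ] ∑[ y ∈ M ] F x y ≡ ∑[ y ∈ M ] ∑[ x ∈ L ] F x y
    ∑-comm F []      M = sym (trans (∑-const 0 M) (ℕ.*-zeroʳ (length M)))
    ∑-comm F (x ∷ L) M = trans (cong (∑ M (F x) +_) (∑-comm F L M))
                               (sym (∑-+ (F x) (λ y → ∑[ x′ ∈ L ] F x′ y) M))

    ∑∑-+-transpose : ∀ (F H : A → A → ℕ) L →
                     ∑[ x ∈ L ] ∑[ y ∈ L ] (F x y + H x y) ≡ ∑[ x ∈ L ] ∑[ y ∈ L ] (F x y + H y x)
    ∑∑-+-transpose F H L = begin
      ∑[ x ∈ L ] ∑[ y ∈ L ] (F x y + H x y)              ≡⟨ ∑-cong L (λ x → ∑-+ (F x) (H x) L) ⟩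
      ∑[ x ∈ L ] (∑ L (F x) + ∑ L (H x))                 ≡⟨ ∑-+ (λ x → ∑ L (F x)) (λ x → ∑ L (H x)) L ⟩
      ∑[ x ∈ L ] ∑ L (F x) + ∑[ x ∈ L ] ∑ L (H x)        ≡⟨ cong (∑[ x ∈ L ] ∑ L (F x) +_) (∑-comm H L L) ⟩
      ∑[ x ∈ L ] ∑ L (F x) + ∑[ x ∈ L ] ∑[ y ∈ L ] H y x ≡⟨ sym (∑-+ (λ x → ∑ L (F x)) (λ x → ∑[ y ∈ L ] H y x) L) ⟩
      ∑[ x ∈ L ] (∑ L (F x) + ∑[ y ∈ L ] H y x)          ≡⟨ ∑-cong L (λ x → sym (∑-+ (F x) (λ y → H y x) L)) ⟩
      ∑[ x ∈ L ] ∑[ y ∈ L ] (F x y + H y x)              ∎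
      where open ≡-Reasoning

    ∑∑-empty : ∀ {B : Set} (M : A → List B) (h : A → B → ℕ) L →
               ∑[ x ∈ L ] length (M x) ≡ 0 → ∑[ x ∈ L ] ∑ (M x) (h x) ≡ 0
    ∑∑-empty M h []      _ = refl
    ∑∑-empty M h (x ∷ L) e with M x
    ∑∑-empty M h (x ∷ L) e  | []    = ∑∑-empty M h L e
    ∑∑-empty M h (x ∷ L) () | _ ∷ _

  <ᵇ-irrefl : ∀ n → (n <ᵇ n) ≡ false
  <ᵇ-irrefl zero    = refl
  <ᵇ-irrefl (suc n) = <ᵇ-irrefl n

  ≡ᵇ-refl : ∀ n → (n ≡ᵇ n) ≡ true
  ≡ᵇ-refl zero    = refl
  ≡ᵇ-refl (suc n) = ≡ᵇ-refl n

  ≢⇒≡ᵇ≡false : ∀ {m n} → m ≢ n → (m ≡ᵇ n) ≡ false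
  ≢⇒≡ᵇ≡false {zero}  {zero}  m≢n = contradiction refl m≢n
  ≢⇒≡ᵇ≡false {zero}  {suc n} _   = refl
  ≢⇒≡ᵇ≡false {suc m} {zero}  _   = refl
  ≢⇒≡ᵇ≡false {suc m} {suc n} m≢n = ≢⇒≡ᵇ≡false (m≢n ∘ cong suc)

  <ᵇ-flip : ∀ {m n} → m ≢ n → (n <ᵇ m) ≡ not (m <ᵇ n)
  <ᵇ-flip {zero}  {zero}  m≢n = contradiction refl m≢n
  <ᵇ-flip {zero}  {suc n} _   = refl
  <ᵇ-flip {suc m} {zero}  _   = refl
  <ᵇ-flip {suc m} {suc n} m≢n = <ᵇ-flip (m≢n ∘ cong suc)

  lex<ᵇ : ℕ → ℕ → ℕ → ℕ → Bool
  lex<ᵇ a b x y = if a <ᵇ b then true else (if a ≡ᵇ b then x <ᵇ y else false)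

  lex<ᵇ-flip : ∀ a b {x y} → x ≢ y → lex<ᵇ b a y x ≡ not (lex<ᵇ a b x y)
  lex<ᵇ-flip a b x≢y with a ℕ.≟ b
  ... | yes refl rewrite <ᵇ-irrefl a | ≡ᵇ-refl a = <ᵇ-flip x≢y
  ... | no a≢b rewrite <ᵇ-flip a≢b | ≢⇒≡ᵇ≡false a≢b | ≢⇒≡ᵇ≡false (a≢b ∘ sym) with a <ᵇ b
  ...   | true  = refl
  ...   | false = refl

  module _ {n : ℕ} (G : SimpleGraph n) where
    open SimpleGraph G using (adj; irrefl) renaming (sym to adj-sym)

    -- `_≺_ G u v` unfolds to `lex<ᵇ (deg G u) (deg G v) (toℕ u) (toℕ v)`.
    ≺-flip : ∀ {u v} → u ≢ v → _≺_ G v u ≡ not (_≺_ G u v)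
    ≺-flip {u} {v} u≢v = lex<ᵇ-flip (deg G u) (deg G v) (u≢v ∘ toℕ-injective)

    ∑-oriented-edges : (_⊏_ : Fin n → Fin n → Bool) → (∀ {u v} → u ≢ v → v ⊏ u ≡ not (u ⊏ v)) →
                       (P : Fin n → ℕ) →
                       ∑[ v ∈ allFin n ] ∑[ u ∈ Γ G v ] ([ v ⊏ u ]· (P v + P u)) ≡ ∑[ v ∈ allFin n ] (deg G v * P v)
    ∑-oriented-edges _⊏_ ⊏-flip P = begin
      ∑[ v ∈ V ] ∑[ u ∈ Γ G v ] ([ v ⊏ u ]· (P v + P u))
        ≡⟨ ∑-cong V (λ v → ∑-filter (adj v) _ V) ⟩
      ∑[ v ∈ V ] ∑[ u ∈ V ] ([ adj v u ]· [ v ⊏ u ]· (P v + P u))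
        ≡⟨ ∑-cong V (λ v → ∑-cong V (λ u → distrib (adj v u) (v ⊏ u))) ⟩
      ∑[ v ∈ V ] ∑[ u ∈ V ] ([ adj v u ]· [ v ⊏ u ]· P v + [ adj v u ]· [ v ⊏ u ]· P u)
        ≡⟨ ∑∑-+-transpose (λ v u → [ adj v u ]· [ v ⊏ u ]· P v) (λ v u → [ adj v u ]· [ v ⊏ u ]· P u) V ⟩
      ∑[ v ∈ V ] ∑[ u ∈ V ] ([ adj v u ]· [ v ⊏ u ]· P v + [ adj u v ]· [ u ⊏ v ]· P v)
        ≡⟨ ∑-cong V (λ v → ∑-cong V (oriented-once v)) ⟩
      ∑[ v ∈ V ] ∑[ u ∈ V ] ([ adj v u ]· P v)
        ≡⟨ ∑-cong V (λ v → trans (sym (∑-filter (adj v) (λ _ → P v) V)) (∑-const (P v) (Γ G v))) ⟩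
      ∑[ v ∈ V ] (deg G v * P v) ∎
      where
      open ≡-Reasoning
      V : List (Fin n)
      V = allFin n

      distrib : ∀ a b {x y} → [ a ]· [ b ]· (x + y) ≡ [ a ]· [ b ]· x + [ a ]· [ b ]· y
      distrib a b {x} {y} = trans (cong ([ a ]·_) ([]·-distrib-+ b x y)) ([]·-distrib-+ a _ _)

      oriented-once : ∀ v u → [ adj v u ]· [ v ⊏ u ]· P v + [ adj u v ]· [ u ⊏ v ]· P v ≡ [ adj v u ]· P v
      oriented-once v u rewrite adj-sym u v with adj v u in e
      ... | false = refl
      ... | true  = trans (cong (λ b → [ v ⊏ u ]· P v + [ b ]· P v) (⊏-flip v≢u)) ([]·-+-[not]· (v ⊏ u) (P v))
        where
        v≢u : v ≢ u
        v≢u refl = case trans (sym e) (irrefl v) of λ ()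

open import Data.Integer as ℤ using (+_; 1ℤ)
import Data.Integer.Properties as ℤ
open import Data.Rational using (ℚ; 0ℚ; 1ℚ; _+_; _*_; _/_; toℚᵘ)
import Data.Rational.Properties as ℚ
open import Data.Rational.Solver using (module +-*-Solver)
open import Data.Rational.Unnormalised as ℚᵘ using (mkℚᵘ; *≡*)
import Data.Rational.Unnormalised.Properties as ℚᵘ

open CommSemigroup (CommutativeMonoid.commutativeSemigroup ℚ.*-1-commutativeMonoid) using (x∙yz≈y∙xz; xy∙z≈y∙xz)
open CommSemigroup (CommutativeMonoid.commutativeSemigroup ℚ.+-0-commutativeMonoid) using (interchange)

-- `+ a / suc k` unfolds to `fromℚᵘ (mkℚᵘ (+ a) k)`.
toℚᵘ-/ : ∀ a k → toℚᵘ (+ a / suc k) ℚᵘ.≃ mkℚᵘ (+ a) k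
toℚᵘ-/ a k = ℚ.toℚᵘ-fromℚᵘ (mkℚᵘ (+ a) k)

fromℕ-+ : ∀ a b → fromℕ (a ℕ.+ b) ≡ fromℕ a + fromℕ b
fromℕ-+ a b = ℚ.toℚᵘ-injective (begin
  toℚᵘ (fromℕ (a ℕ.+ b))              ≈⟨ toℚᵘ-/ (a ℕ.+ b) 0 ⟩
  mkℚᵘ (+ (a ℕ.+ b)) 0                ≈⟨ *≡* cross-multiplied ⟩
  mkℚᵘ (+ a) 0 ℚᵘ.+ mkℚᵘ (+ b) 0      ≈⟨ ℚᵘ.+-cong (toℚᵘ-/ a 0) (toℚᵘ-/ b 0) ⟨
  toℚᵘ (fromℕ a) ℚᵘ.+ toℚᵘ (fromℕ b)  ≈⟨ ℚ.toℚᵘ-homo-+ (fromℕ a) (fromℕ b) ⟨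
  toℚᵘ (fromℕ a + fromℕ b)            ∎)
  where
  open ℚᵘ.≃-Reasoning
  cross-multiplied : + (a ℕ.+ b) ℤ.* 1ℤ ≡ (+ a ℤ.* 1ℤ ℤ.+ + b ℤ.* 1ℤ) ℤ.* 1ℤ
  cross-multiplied = trans (ℤ.*-identityʳ _) (trans (ℤ.pos-+ a b) (sym
    (trans (ℤ.*-identityʳ _) (cong₂ ℤ._+_ (ℤ.*-identityʳ (+ a)) (ℤ.*-identityʳ (+ b))))))

/≡fromℕ*1/ : ∀ a d .{{_ : NonZero d}} → + a / d ≡ fromℕ a * (+ 1 / d)
/≡fromℕ*1/ a (suc k) = ℚ.toℚᵘ-injective (begin
  toℚᵘ (+ a / suc k)                          ≈⟨ toℚᵘ-/ a k ⟩
  mkℚᵘ (+ a) k                                ≈⟨ *≡* (cong₂ ℤ._*_ (sym (ℤ.*-identityʳ (+ a))) (cong +_ (ℕ.*-identityˡ (suc k)))) ⟩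
  mkℚᵘ (+ a) 0 ℚᵘ.* mkℚᵘ (+ 1) k              ≈⟨ ℚᵘ.*-cong (toℚᵘ-/ a 0) (toℚᵘ-/ 1 k) ⟨
  toℚᵘ (fromℕ a) ℚᵘ.* toℚᵘ (+ 1 / suc k)      ≈⟨ ℚ.toℚᵘ-homo-* (fromℕ a) (+ 1 / suc k) ⟨
  toℚᵘ (fromℕ a * (+ 1 / suc k))              ∎)
  where open ℚᵘ.≃-Reasoning

fromℕ*1/≡1 : ∀ d .{{_ : NonZero d}} → fromℕ d * (+ 1 / d) ≡ 1ℚ
fromℕ*1/≡1 d@(suc k) = trans (sym (/≡fromℕ*1/ d d))
  (ℚ.toℚᵘ-injective (ℚᵘ.≃-trans (toℚᵘ-/ d k) (*≡* (ℤ.*-comm (+ d) 1ℤ))))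

fromℕ-cancelˡ : ∀ d .{{_ : NonZero d}} x → fromℕ d * ((+ 1 / d) * x) ≡ x
fromℕ-cancelˡ d x = begin
  fromℕ d * ((+ 1 / d) * x) ≡⟨ ℚ.*-assoc (fromℕ d) (+ 1 / d) x ⟨
  fromℕ d * (+ 1 / d) * x   ≡⟨ cong (_* x) (fromℕ*1/≡1 d) ⟩
  1ℚ * x                    ≡⟨ ℚ.*-identityˡ x ⟩
  x                         ∎
  where open ≡-Reasoning

1/-cancelˡ : ∀ d .{{_ : NonZero d}} x → (+ 1 / d) * (fromℕ d * x) ≡ x
1/-cancelˡ d x = trans (x∙yz≈y∙xz (+ 1 / d) (fromℕ d) x) (fromℕ-cancelˡ d x)

scale-cancel : ∀ a d q .{{_ : NonZero d}} .{{_ : NonZero q}} x →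
               a * (+ d / q) * (fromℕ q * ((+ 1 / d) * x)) ≡ a * x
scale-cancel a d q x = begin
  a * (+ d / q) * (fromℕ q * ((+ 1 / d) * x))
    ≡⟨ cong (λ z → a * z * (fromℕ q * ((+ 1 / d) * x))) (/≡fromℕ*1/ d q) ⟩
  a * (fromℕ d * (+ 1 / q)) * (fromℕ q * ((+ 1 / d) * x))
    ≡⟨ regroup a (fromℕ d) (+ 1 / q) (fromℕ q) ((+ 1 / d) * x) ⟩
  a * (fromℕ q * (+ 1 / q) * (fromℕ d * ((+ 1 / d) * x)))
    ≡⟨ cong₂ (λ y z → a * (y * z)) (fromℕ*1/≡1 q) (fromℕ-cancelˡ d x) ⟩
  a * (1ℚ * x)
    ≡⟨ cong (a *_) (ℚ.*-identityˡ x) ⟩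
  a * x
    ∎
  where
  open ≡-Reasoning
  open +-*-Solver
  regroup : ∀ a b c e y → a * (b * c) * (e * y) ≡ a * (e * c * (b * y))
  regroup = solve 5 (λ a b c e y → a :* (b :* c) :* (e :* y) := a :* (e :* c :* (b :* y))) refl

𝔼 : {A : Set} → Dist A → (A → ℚ) → ℚ
𝔼 []            g = 0ℚ
𝔼 ((p , x) ∷ D) g = p * g x + 𝔼 D g

mass : {A : Set} → Dist A → ℚ
mass D = 𝔼 D (λ _ → 1ℚ)

module _ {A : Set} where

  𝔼-cong : ∀ (D : Dist A) {g h : A → ℚ} → (∀ x → g x ≡ h x) → 𝔼 D g ≡ 𝔼 D h
  𝔼-cong []            g≗h = refl
  𝔼-cong ((p , x) ∷ D) g≗h = cong₂ (λ y z → p * y + z) (g≗h x) (𝔼-cong D g≗h)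

  𝔼-return : ∀ x (g : A → ℚ) → 𝔼 (return x) g ≡ g x
  𝔼-return x g = trans (ℚ.+-identityʳ _) (ℚ.*-identityˡ (g x))

  𝔼-++ : ∀ (D D′ : Dist A) g → 𝔼 (D ++ D′) g ≡ 𝔼 D g + 𝔼 D′ g
  𝔼-++ []            D′ g = sym (ℚ.+-identityˡ _)
  𝔼-++ ((p , x) ∷ D) D′ g = trans (cong (_+_ (p * g x)) (𝔼-++ D D′ g)) (sym (ℚ.+-assoc (p * g x) (𝔼 D g) (𝔼 D′ g)))

  𝔼-*ˡ : ∀ (D : Dist A) c g → 𝔼 D (λ x → c * g x) ≡ c * 𝔼 D g
  𝔼-*ˡ []            c g = sym (ℚ.*-zeroʳ c)
  𝔼-*ˡ ((p , x) ∷ D) c g = begin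
    p * (c * g x) + 𝔼 D (λ y → c * g y) ≡⟨ cong₂ _+_ (x∙yz≈y∙xz p c (g x)) (𝔼-*ˡ D c g) ⟩
    c * (p * g x) + c * 𝔼 D g           ≡⟨ ℚ.*-distribˡ-+ c _ _ ⟨
    c * (p * g x + 𝔼 D g)               ∎
    where open ≡-Reasoning

  𝔼-+ : ∀ (D : Dist A) g h → 𝔼 D (λ x → g x + h x) ≡ 𝔼 D g + 𝔼 D h
  𝔼-+ []            g h = sym (ℚ.+-identityˡ 0ℚ)
  𝔼-+ ((p , x) ∷ D) g h = begin
    p * (g x + h x) + 𝔼 D (λ y → g y + h y)    ≡⟨ cong₂ _+_ (ℚ.*-distribˡ-+ p _ _) (𝔼-+ D g h) ⟩
    (p * g x + p * h x) + (𝔼 D g + 𝔼 D h)      ≡⟨ interchange (p * g x) (p * h x) (𝔼 D g) (𝔼 D h) ⟩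
    (p * g x + 𝔼 D g) + (p * h x + 𝔼 D h)      ∎
    where open ≡-Reasoning

  𝔼-const : ∀ (D : Dist A) c → mass D ≡ 1ℚ → 𝔼 D (λ _ → c) ≡ c
  𝔼-const D c mass≡1 = begin
    𝔼 D (λ _ → c)       ≡⟨ 𝔼-cong D (λ _ → sym (ℚ.*-identityʳ c)) ⟩
    𝔼 D (λ _ → c * 1ℚ)  ≡⟨ 𝔼-*ˡ D c (λ _ → 1ℚ) ⟩
    c * mass D          ≡⟨ cong (c *_) mass≡1 ⟩
    c * 1ℚ              ≡⟨ ℚ.*-identityʳ c ⟩
    c                   ∎
    where open ≡-Reasoning

  𝔼-scale : ∀ p (D : Dist A) g → 𝔼 (map (λ y → (p * proj₁ y , proj₂ y)) D) g ≡ p * 𝔼 D g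
  𝔼-scale p []             g = sym (ℚ.*-zeroʳ p)
  𝔼-scale p ((p′ , x) ∷ D) g = trans (cong₂ _+_ (ℚ.*-assoc p p′ (g x)) (𝔼-scale p D g))
                                     (sym (ℚ.*-distribˡ-+ p _ _))

𝔼->>= : ∀ {A B : Set} (D : Dist A) (f : A → Dist B) g → 𝔼 (D >>= f) g ≡ 𝔼 D (λ x → 𝔼 (f x) g)
𝔼->>= []            f g = refl
𝔼->>= ((p , x) ∷ D) f g = trans (𝔼-++ (map (λ y → (p * proj₁ y , proj₂ y)) (f x)) (D >>= f) g)
                                (cong₂ _+_ (𝔼-scale p (f x) g) (𝔼->>= D f g))

expectation≡𝔼 : ∀ D → expectation D ≡ 𝔼 D id
expectation≡𝔼 []            = refl
expectation≡𝔼 ((p , x) ∷ D) = cong (_+_ (p * x)) (expectation≡𝔼 D)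

expectation->>= : ∀ {A : Set} (D : Dist A) f → expectation (D >>= f) ≡ 𝔼 D (expectation ∘ f)
expectation->>= D f = trans (expectation≡𝔼 (D >>= f))
                            (trans (𝔼->>= D f id) (𝔼-cong D (sym ∘ expectation≡𝔼 ∘ f)))

expectation-return : ∀ x → expectation (return x) ≡ x
expectation-return x = 𝔼-return x id

module _ {A : Set} (D : Dist A) where

  𝔼-iid-suc : ∀ k φ → 𝔼 (iid (suc k) D) φ ≡ 𝔼 D (λ x → 𝔼 (iid k D) (λ xs → φ (x ∷ xs)))
  𝔼-iid-suc k φ = trans (𝔼->>= D _ φ) (𝔼-cong D (λ x →
    trans (𝔼->>= (iid k D) (λ xs → return (x ∷ xs)) φ) (𝔼-cong (iid k D) (λ xs → 𝔼-return (x ∷ xs) φ))))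

  mass-iid : mass D ≡ 1ℚ → ∀ k → mass (iid k D) ≡ 1ℚ
  mass-iid mass≡1 zero    = refl
  mass-iid mass≡1 (suc k) = trans (𝔼-iid-suc k (λ _ → 1ℚ))
                                  (trans (𝔼-cong D (λ _ → mass-iid mass≡1 k)) mass≡1)

  𝔼-iid-∑ : mass D ≡ 1ℚ → ∀ (h : A → ℕ) k →
            𝔼 (iid k D) (λ xs → fromℕ (∑ xs h)) ≡ fromℕ k * 𝔼 D (fromℕ ∘ h)
  𝔼-iid-∑ mass≡1 h zero    = sym (ℚ.*-zeroˡ (𝔼 D (fromℕ ∘ h)))
  𝔼-iid-∑ mass≡1 h (suc k) = begin
    𝔼 (iid (suc k) D) (λ xs → fromℕ (∑ xs h))
      ≡⟨ 𝔼-iid-suc k (λ xs → fromℕ (∑ xs h)) ⟩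
    𝔼 D (λ x → 𝔼 (iid k D) (λ xs → fromℕ (h x ℕ.+ ∑ xs h)))
      ≡⟨ 𝔼-cong D (λ x → fresh-draw (h x)) ⟩
    𝔼 D (λ x → fromℕ (h x) + fromℕ k * E)
      ≡⟨ 𝔼-+ D (fromℕ ∘ h) (λ _ → fromℕ k * E) ⟩
    E + 𝔼 D (λ _ → fromℕ k * E)
      ≡⟨ cong (_+_ E) (𝔼-const D (fromℕ k * E) mass≡1) ⟩
    E + fromℕ k * E
      ≡⟨ cong (_+ fromℕ k * E) (ℚ.*-identityˡ E) ⟨
    1ℚ * E + fromℕ k * E
      ≡⟨ ℚ.*-distribʳ-+ E 1ℚ (fromℕ k) ⟨
    (1ℚ + fromℕ k) * E
      ≡⟨ cong (_* E) (fromℕ-+ 1 k) ⟨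
    fromℕ (suc k) * E
      ∎
    where
    open ≡-Reasoning
    E : ℚ
    E = 𝔼 D (fromℕ ∘ h)

    fresh-draw : ∀ m → 𝔼 (iid k D) (λ xs → fromℕ (m ℕ.+ ∑ xs h)) ≡ fromℕ m + fromℕ k * E
    fresh-draw m = begin
      𝔼 (iid k D) (λ xs → fromℕ (m ℕ.+ ∑ xs h))     ≡⟨ 𝔼-cong (iid k D) (λ xs → fromℕ-+ m (∑ xs h)) ⟩
      𝔼 (iid k D) (λ xs → fromℕ m + fromℕ (∑ xs h)) ≡⟨ 𝔼-+ (iid k D) (λ _ → fromℕ m) (λ xs → fromℕ (∑ xs h)) ⟩
      𝔼 (iid k D) (λ _ → fromℕ m) + 𝔼 (iid k D) (λ xs → fromℕ (∑ xs h))
        ≡⟨ cong₂ _+_ (𝔼-const (iid k D) (fromℕ m) (mass-iid mass≡1 k)) (𝔼-iid-∑ mass≡1 h k) ⟩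
      fromℕ m + fromℕ k * E                         ∎

module _ {A : Set} (h : A → ℕ) where

  𝔼-constant-weight : ∀ c L → 𝔼 (map (λ x → (c , x)) L) (fromℕ ∘ h) ≡ c * fromℕ (∑ L h)
  𝔼-constant-weight c []      = sym (ℚ.*-zeroʳ c)
  𝔼-constant-weight c (x ∷ L) = begin
    c * fromℕ (h x) + 𝔼 (map (λ y → (c , y)) L) (fromℕ ∘ h) ≡⟨ cong (_+_ (c * fromℕ (h x))) (𝔼-constant-weight c L) ⟩
    c * fromℕ (h x) + c * fromℕ (∑ L h)                      ≡⟨ ℚ.*-distribˡ-+ c _ _ ⟨
    c * (fromℕ (h x) + fromℕ (∑ L h))                        ≡⟨ cong (c *_) (fromℕ-+ (h x) (∑ L h)) ⟨
    c * fromℕ (∑ (x ∷ L) h)                                  ∎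
    where open ≡-Reasoning

  length*𝔼-uniformList : ∀ L → fromℕ (length L) * 𝔼 (uniformList L) (fromℕ ∘ h) ≡ fromℕ (∑ L h)
  length*𝔼-uniformList []       = refl
  length*𝔼-uniformList (x ∷ xs) = trans (cong (fromℕ m *_) (𝔼-constant-weight (+ 1 / m) (x ∷ xs)))
                                        (fromℕ-cancelˡ m _)
    where
    m : ℕ
    m = suc (length xs)

𝔼-uniform-allFin : ∀ n .{{_ : NonZero n}} (h : Fin n → ℕ) →
                   𝔼 (uniformList (allFin n)) (fromℕ ∘ h) ≡ (+ 1 / n) * fromℕ (∑ (allFin n) h)
𝔼-uniform-allFin n h = begin
  E                                                  ≡⟨ 1/-cancelˡ n E ⟨
  (+ 1 / n) * (fromℕ n * E)                          ≡⟨ cong (λ m → (+ 1 / n) * (fromℕ m * E)) (length-tabulate {n = n} id) ⟨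
  (+ 1 / n) * (fromℕ (length (allFin n)) * E)        ≡⟨ cong ((+ 1 / n) *_) (length*𝔼-uniformList h (allFin n)) ⟩
  (+ 1 / n) * fromℕ (∑ (allFin n) h)                 ∎
  where
  open ≡-Reasoning
  E : ℚ
  E = 𝔼 (uniformList (allFin n)) (fromℕ ∘ h)

mass-uniform-allFin : ∀ n .{{_ : NonZero n}} → mass (uniformList (allFin n)) ≡ 1ℚ
mass-uniform-allFin n = begin
  mass (uniformList (allFin n))               ≡⟨ 𝔼-uniform-allFin n (λ _ → 1) ⟩
  (+ 1 / n) * fromℕ (∑[ _ ∈ allFin n ] 1)     ≡⟨ cong (λ m → (+ 1 / n) * fromℕ m) count ⟩
  (+ 1 / n) * fromℕ n                         ≡⟨ ℚ.*-comm (+ 1 / n) (fromℕ n) ⟩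
  fromℕ n * (+ 1 / n)                         ≡⟨ fromℕ*1/≡1 n ⟩
  1ℚ                                          ∎
  where
  open ≡-Reasoning
  count : ∑[ _ ∈ allFin n ] 1 ≡ n
  count = trans (∑-const 1 (allFin n)) (trans (ℕ.*-identityʳ _) (length-tabulate {n = n} id))

𝔼-weighted : ∀ {A : Set} (w S : A → ℕ) (φ : A → ℚ) d .{{_ : NonZero d}} →
             (∀ x → fromℕ (w x) * φ x ≡ fromℕ (S x)) →
             ∀ L → 𝔼 (map (λ x → (+ w x / d , x)) L) φ ≡ (+ 1 / d) * fromℕ (∑ L S)
𝔼-weighted w S φ d wφ≡S []      = sym (ℚ.*-zeroʳ (+ 1 / d))
𝔼-weighted w S φ d wφ≡S (x ∷ L) = begin
  (+ w x / d) * φ x + 𝔼 (map (λ y → (+ w y / d , y)) L) φ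
    ≡⟨ cong₂ _+_ weight (𝔼-weighted w S φ d wφ≡S L) ⟩
  (+ 1 / d) * fromℕ (S x) + (+ 1 / d) * fromℕ (∑ L S)
    ≡⟨ ℚ.*-distribˡ-+ (+ 1 / d) _ _ ⟨
  (+ 1 / d) * (fromℕ (S x) + fromℕ (∑ L S))
    ≡⟨ cong ((+ 1 / d) *_) (fromℕ-+ (S x) (∑ L S)) ⟨
  (+ 1 / d) * fromℕ (∑ (x ∷ L) S)
    ∎
  where
  open ≡-Reasoning
  weight : (+ w x / d) * φ x ≡ (+ 1 / d) * fromℕ (S x)
  weight = begin
    (+ w x / d) * φ x                ≡⟨ cong (_* φ x) (/≡fromℕ*1/ (w x) d) ⟩
    fromℕ (w x) * (+ 1 / d) * φ x    ≡⟨ xy∙z≈y∙xz (fromℕ (w x)) (+ 1 / d) (φ x) ⟩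
    (+ 1 / d) * (fromℕ (w x) * φ x)  ≡⟨ cong ((+ 1 / d) *_) (wφ≡S x) ⟩
    (+ 1 / d) * fromℕ (S x)          ∎

𝔼-sizeBiased-uniform : ∀ {A B C : Set} (N : A → List B) (k : A → B → C) (h : C → ℕ) d .{{_ : NonZero d}} L →
  𝔼 (map (λ x → (+ length (N x) / d , x)) L >>= λ x → uniformList (N x) >>= λ y → return (k x y)) (fromℕ ∘ h)
    ≡ (+ 1 / d) * fromℕ (∑[ x ∈ L ] ∑[ y ∈ N x ] h (k x y))
𝔼-sizeBiased-uniform N k h d L =
  trans (𝔼->>= (map (λ x → (+ length (N x) / d , x)) L) _ (fromℕ ∘ h))
        (𝔼-weighted (length ∘ N) (λ x → ∑[ y ∈ N x ] h (k x y)) _ d uniform-neighbour L)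
  where
  uniform-neighbour : ∀ x → fromℕ (length (N x)) * 𝔼 (uniformList (N x) >>= λ y → return (k x y)) (fromℕ ∘ h)
                            ≡ fromℕ (∑[ y ∈ N x ] h (k x y))
  uniform-neighbour x = trans (cong (fromℕ (length (N x)) *_)
                                    (trans (𝔼->>= (uniformList (N x)) (λ y → return (k x y)) (fromℕ ∘ h))
                                           (𝔼-cong (uniformList (N x)) (λ y → 𝔼-return (k x y) (fromℕ ∘ h)))))
                              (length*𝔼-uniformList (h ∘ k x) (N x))

module _ {n : ℕ} (G : SimpleGraph n) (s : ℕ) where

  -- X v u is the value of X_i when v_i = v and u_i = u.
  X : Fin n → Fin n → ℕ
  X v u = [ _≺_ G v u ]· (deg G v ^ (s ∸ 1) ℕ.+ deg G u ^ (s ∸ 1))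

  ∑X : Fin n → ℕ
  ∑X v = ∑[ u ∈ Γ G v ] X v u

  mass-oneSample : ∀ R d .{{_ : NonZero d}} → ∑ R (deg G) ≡ d → mass (oneSample G s R d) ≡ 1ℚ
  mass-oneSample R d ∑deg≡d = begin
    mass (oneSample G s R d)                          ≡⟨ 𝔼-sizeBiased-uniform (Γ G) X (λ _ → 1) d R ⟩
    (+ 1 / d) * fromℕ (∑[ v ∈ R ] ∑[ _ ∈ Γ G v ] 1)  ≡⟨ cong (λ m → (+ 1 / d) * fromℕ m) count ⟩
    (+ 1 / d) * fromℕ d                               ≡⟨ ℚ.*-comm (+ 1 / d) (fromℕ d) ⟩
    fromℕ d * (+ 1 / d)                               ≡⟨ fromℕ*1/≡1 d ⟩
    1ℚ                                                ∎
    where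
    open ≡-Reasoning
    count : ∑[ v ∈ R ] ∑[ _ ∈ Γ G v ] 1 ≡ d
    count = trans (∑-cong R (λ v → trans (∑-const 1 (Γ G v)) (ℕ.*-identityʳ _))) ∑deg≡d

module _ {n : ℕ} .{{_ : NonZero n}} (G : SimpleGraph n) (s r q : ℕ) .{{_ : NonZero r}} .{{_ : NonZero q}} where

  private
    U : Dist (Fin n)
    U = uniformList (allFin n)

  expectation-estimate-suc : ∀ R k → ∑ R (deg G) ≡ suc k →
    expectation (iid q (oneSample G s R (suc k)) >>= λ Xs → return ((+ 1 / r) * (+ suc k / q) * fromℕ (sumℕ Xs)))
      ≡ (+ 1 / r) * fromℕ (∑ R (∑X G s))
  expectation-estimate-suc R k ∑deg≡d = begin
    expectation (iid q OS >>= λ Xs → return (c * fromℕ (sumℕ Xs)))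
      ≡⟨ expectation->>= (iid q OS) _ ⟩
    𝔼 (iid q OS) (λ Xs → expectation (return (c * fromℕ (sumℕ Xs))))
      ≡⟨ 𝔼-cong (iid q OS) (λ Xs → trans (expectation-return _) (cong (λ ys → c * fromℕ (sumℕ ys)) (sym (map-id Xs)))) ⟩
    𝔼 (iid q OS) (λ Xs → c * fromℕ (∑ Xs id))
      ≡⟨ 𝔼-*ˡ (iid q OS) c _ ⟩
    c * 𝔼 (iid q OS) (λ Xs → fromℕ (∑ Xs id))
      ≡⟨ cong (c *_) (𝔼-iid-∑ OS (mass-oneSample G s R d ∑deg≡d) id q) ⟩
    c * (fromℕ q * 𝔼 OS fromℕ)
      ≡⟨ cong (λ e → c * (fromℕ q * e)) (𝔼-sizeBiased-uniform (Γ G) (X G s) id d R) ⟩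
    c * (fromℕ q * ((+ 1 / d) * fromℕ (∑ R (∑X G s))))
      ≡⟨ scale-cancel (+ 1 / r) d q _ ⟩
    (+ 1 / r) * fromℕ (∑ R (∑X G s))
      ∎
    where
    open ≡-Reasoning
    d : ℕ
    d = suc k
    OS : Dist ℕ
    OS = oneSample G s R d
    c : ℚ
    c = (+ 1 / r) * (+ d / q)

  -- The rounds of `Approx` are a function local to its definition; this gives it a name.
  Approx-as-bind : Σ[ estimate ∈ (List (Fin n) → Dist ℚ) ] Approx G s r q ≡ (iid r U >>= estimate)
  Approx-as-bind = _ , refl

  private
    estimate : List (Fin n) → Dist ℚ
    estimate = proj₁ Approx-as-bind

  expectation-estimate : ∀ R → expectation (estimate R) ≡ (+ 1 / r) * fromℕ (∑ R (∑X G s))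
  expectation-estimate R with ∑ R (deg G) in ∑deg≡d
  ... | zero  = sym (begin
    (+ 1 / r) * fromℕ (∑ R (∑X G s)) ≡⟨ cong (λ m → (+ 1 / r) * fromℕ m) (∑∑-empty (Γ G) (X G s) R ∑deg≡d) ⟩
    (+ 1 / r) * 0ℚ                    ≡⟨ ℚ.*-zeroʳ (+ 1 / r) ⟩
    0ℚ                                ≡⟨ expectation-return 0ℚ ⟨
    expectation (return 0ℚ)           ∎)
    where open ≡-Reasoning
  ... | suc k = expectation-estimate-suc R k ∑deg≡d

  expectation-Approx : expectation (Approx G s r q) ≡ 𝔼 U (fromℕ ∘ ∑X G s)
  expectation-Approx = begin
    expectation (Approx G s r q)
      ≡⟨ expectation->>= (iid r U) estimate ⟩
    𝔼 (iid r U) (λ R → expectation (estimate R))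
      ≡⟨ 𝔼-cong (iid r U) expectation-estimate ⟩
    𝔼 (iid r U) (λ R → (+ 1 / r) * fromℕ (∑ R (∑X G s)))
      ≡⟨ 𝔼-*ˡ (iid r U) (+ 1 / r) _ ⟩
    (+ 1 / r) * 𝔼 (iid r U) (λ R → fromℕ (∑ R (∑X G s)))
      ≡⟨ cong ((+ 1 / r) *_) (𝔼-iid-∑ U (mass-uniform-allFin n) (∑X G s) r) ⟩
    (+ 1 / r) * (fromℕ r * 𝔼 U (fromℕ ∘ ∑X G s))
      ≡⟨ 1/-cancelˡ r _ ⟩
    𝔼 U (fromℕ ∘ ∑X G s)
      ∎
    where open ≡-Reasoning

mainTheorem3 : (n : ℕ) .{{_ : NonZero n}} (G : SimpleGraph n) (s r q : ℕ)
               .{{_ : NonZero r}} .{{_ : NonZero q}} → s ≥ 1 →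
               expectation (Approx G s r q) ≡ μ̄ G s
mainTheorem3 n G zero    r q ()
mainTheorem3 n G (suc s) r q _ = begin
  expectation (Approx G (suc s) r q)                 ≡⟨ expectation-Approx G (suc s) r q ⟩
  𝔼 (uniformList (allFin n)) (fromℕ ∘ ∑X G (suc s))  ≡⟨ 𝔼-uniform-allFin n (∑X G (suc s)) ⟩
  (+ 1 / n) * fromℕ (∑ (allFin n) (∑X G (suc s)))    ≡⟨ cong (λ m → (+ 1 / n) * fromℕ m)
                                                          (∑-oriented-edges G (_≺_ G) (≺-flip G) (λ v → deg G v ^ s)) ⟩
  μ̄ G (suc s)                                        ∎
  where open ≡-Reasoning
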